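{- For every integer $n\geq 2$ and every integer $k\geq 3$, the distinguishing number of the dutch windmill graph $D_n^k$ is $$D(D_n^k)=\min\left\{r\in\mathbb{N}:~\frac{r^{k-1}-r^{\lceil (k-1)/2 \rceil}}{2}\geq n\right\}.$$
   Context: All graphs are simple. The dutch windmill graph $D_n^k$ ($n\geq 2$, $k\geq 3$) is the graph obtained by taking $n$ copies of the cycle $C_k$ and identifying one vertex from each copy into a single common (central) vertex. The distinguishing number $D(G)$ of a graph $G$ is the least number $d$ such that there is a labeling of the vertices of $G$ with $d$ labels that is preserved only by the identity automorphism of $G$. -}

module Defs where

open import Data.Nat using (ℕ; zero; suc; _∸_; _^_; _≤_; _*_; ⌈_/2⌉; _/_)
open import Data.Fin using (Fin; toℕ)
open import Data.Unit using (⊤; tt)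
open import Data.Sum using (_⊎_; inj₁; inj₂)
open import Data.Product using (_×_; _,_; Σ; ∃)
open import Function.Bundles using (_↔_; Inverse; _⇔_)
open import Relation.Binary.PropositionalEquality using (_≡_)

record Graph : Set₁ where
  field
    V   : Set
    Adj : V → V → Set
open Graph public

record Automorphism (G : Graph) : Set where
  field
    perm    : V G ↔ V G
    adj-iff : ∀ u v → Adj G u v ⇔ Adj G (Inverse.to perm u) (Inverse.to perm v)
open Automorphism public

apply : {G : Graph} → Automorphism G → V G → V G
apply σ = Inverse.to (perm σ)

Labeling : Graph → ℕ → Set
Labeling G d = V G → Fin d

Preserves : {G : Graph} {d : ℕ} → Automorphism G → Labeling G d → Set
Preserves σ c = ∀ v → c (apply σ v) ≡ c v

Distinguishing : {G : Graph} {d : ℕ} → Labeling G d → Set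
Distinguishing {G} {d} c = (σ : Automorphism G) → Preserves {G} {d} σ c → ∀ v → apply σ v ≡ v

HasDistLabeling : Graph → ℕ → Set
HasDistLabeling G d = Σ (Labeling G d) (Distinguishing {G} {d})

IsLeast : (ℕ → Set) → ℕ → Set
IsLeast P d = P d × (∀ r → P r → d ≤ r)

IsDistinguishingNumber : Graph → ℕ → Set
IsDistinguishingNumber G d = IsLeast (HasDistLabeling G) d

-- Vertices: the centre (inj₁ tt), and for each copy i : Fin n of C_k the
-- k-1 non-central vertices (i , j), j : Fin (k ∸ 1); vertex (i , j) sits at
-- position j+1 of the i-th cycle c₀ c₁ … c_{k-1}, with c₀ the centre.
WVertex : ℕ → ℕ → Set
WVertex n k = ⊤ ⊎ (Fin n × Fin (k ∸ 1))

data WEdge (n k : ℕ) : WVertex n k → WVertex n k → Set where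
  centre-first : ∀ i (j : Fin (k ∸ 1)) → toℕ j ≡ 0 → WEdge n k (inj₁ tt) (inj₂ (i , j))
  last-centre  : ∀ i (j : Fin (k ∸ 1)) → toℕ j ≡ k ∸ 2 → WEdge n k (inj₂ (i , j)) (inj₁ tt)
  step         : ∀ i (j j′ : Fin (k ∸ 1)) → toℕ j′ ≡ suc (toℕ j) → WEdge n k (inj₂ (i , j)) (inj₂ (i , j′))

DutchWindmill : ℕ → ℕ → Graph
DutchWindmill n k = record
  { V   = WVertex n k
  ; Adj = λ u v → WEdge n k u v ⊎ WEdge n k v u
  }

WindmillBound : ℕ → ℕ → ℕ → Set
WindmillBound n k r = n ≤ (r ^ (k ∸ 1) ∸ r ^ ⌈ k ∸ 1 /2⌉) / 2

-- Every blade of D_n^k is a path of m = k-1 vertices whose two ends are joined to the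
-- centre, so a labeling with r labels reads a word of length m over Fin r along each blade.
--  * Words (section Words): stored from the outside in (OWord), so that reversal and the
--    comparison of the two outer letters are structural.  The non-palindromic words up to
--    reversal are enumerated by canonical representatives (Class); there are classCount m
--    of them, and 2 · classCount m + r^⌈m/2⌉ = r^m (classCount-formula).
--  * Automorphisms (module Windmill): with two blades, the centre is the only vertex with
--    three neighbours, so every adjacency-preserving injection fixes it (centre-fixed) and
--    then maps each blade onto a blade, in order or reversed (rigid).  Conversely every
--    permutation of the blades, reflecting some of them, is an automorphism.
--  * Hence (module Characterisation) a labeling is distinguishing exactly when its blade
--    words are non-palindromes in pairwise distinct classes, so a distinguishing labeling
--    with r labels exists iff n ≤ classCount m; the theorem follows by taking least elements.

module Submission where

open import Defs
open import Data.Bool using (Bool; true; false; _xor_; _∧_; _∨_)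
open import Data.Empty using (⊥; ⊥-elim)
open import Data.Fin using (Fin; zero; suc; toℕ; inject₁; inject≤; fromℕ; opposite; _≟_)
open import Data.Fin.Induction using (<-weakInduction)
open import Data.Fin.Permutation using (Permutation′; _⟨$⟩ʳ_; _⟨$⟩ˡ_; inverseˡ; inverseʳ; transpose)
open import Data.Fin.Properties
  using (suc-injective; toℕ-injective; toℕ-fromℕ; toℕ-inject₁; opposite-involutive;
         +↔⊎; *↔×; 1↔⊤; injective⇒≤; inject≤-injective)
open import Data.Fin.Relation.Unary.Top using (view; ‵fromℕ; ‵inject₁; view-fromℕ; view-inject₁)
open import Data.Maybe using (Maybe; just; nothing; map)
open import Data.Maybe.Properties using (just-injective)
open import Data.Nat using (ℕ; zero; suc; _+_; _*_; _∸_; _^_; _≤_; s≤s; ⌈_/2⌉; _/_)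
open import Data.Nat.DivMod using (m*n/n≡m)
open import Data.Nat.Properties using (*-identityʳ; *-comm; *-assoc; *-distribʳ-+; m+n∸n≡m)
import Data.Nat.Properties as ℕ
open import Data.Nat.Solver using (module +-*-Solver)
open import Data.Product using (Σ; _×_; _,_; proj₁; proj₂)
open import Data.Product.Function.NonDependent.Propositional using (_×-↔_)
open import Data.Sum using (_⊎_; inj₁; inj₂; swap)
open import Data.Sum.Function.Propositional using (_⊎-↔_)
open import Data.Unit using (tt)
open import Function using (_∘_; _$_)
open import Function.Bundles using (_↔_; _⇔_; Inverse; Injection; Equivalence; mk↔ₛ′; mk⇔)
open import Function.Definitions using (Injective)
open import Function.Properties.Inverse using (↔-refl; ↔-trans; ↔⇒↣)
open import Relation.Binary.PropositionalEquality
  using (_≡_; _≢_; refl; sym; trans; cong; cong₂; subst; subst₂; _≗_; module ≡-Reasoning)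
open import Relation.Nullary using (¬_; Dec; yes; no; does)
open import Relation.Nullary.Decidable using (dec-true; dec-false)

opposite-inject₁ : ∀ {m} (j : Fin m) → opposite (inject₁ j) ≡ suc (opposite j)
opposite-inject₁ {suc m} zero    = refl
opposite-inject₁ {suc m} (suc j) = cong inject₁ (opposite-inject₁ j)

opposite-fromℕ : ∀ m → opposite (fromℕ m) ≡ zero
opposite-fromℕ zero    = refl
opposite-fromℕ (suc m) = cong inject₁ (opposite-fromℕ m)

reflectIf : ∀ {m} → Bool → Fin m → Fin m
reflectIf false j = j
reflectIf true  j = opposite j

reflectIf-involutive : ∀ {m} b (j : Fin m) → reflectIf b (reflectIf b j) ≡ j
reflectIf-involutive false j = refl
reflectIf-involutive true  j = opposite-involutive j

Card : Set → ℕ → Set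
Card A s = Fin s ↔ A

card-via : ∀ {A B : Set} {s} → Card A s → (f : A → B) (g : B → A) →
           (∀ y → f (g y) ≡ y) → (∀ x → g (f x) ≡ x) → Card B s
card-via c f g fg gf = ↔-trans c (mk↔ₛ′ f g fg gf)

card-⊎ : ∀ {A B : Set} {a b} → Card A a → Card B b → Card (A ⊎ B) (a + b)
card-⊎ ca cb = ↔-trans +↔⊎ (ca ⊎-↔ cb)

card-× : ∀ {A B : Set} {a b} → Card A a → Card B b → Card (A × B) (a * b)
card-× ca cb = ↔-trans *↔× (ca ×-↔ cb)

injection-bound : ∀ {A : Set} {s n} → Card A s → (f : Fin n → A) → Injective _≡_ _≡_ f → n ≤ s
injection-bound c f f-inj =
  injective⇒≤ (λ e → f-inj (trans (sym (Inverse.strictlyInverseˡ c _))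
                               (trans (cong (Inverse.to c) e) (Inverse.strictlyInverseˡ c _))))

distinct-elements : ∀ {A : Set} {s n} → Card A s → n ≤ s → Σ (Fin n → A) (Injective _≡_ _≡_)
distinct-elements c n≤s =
  (λ i → Inverse.to c (inject≤ i n≤s)) ,
  (λ e → inject≤-injective n≤s n≤s _ _
           (trans (sym (Inverse.strictlyInverseʳ c _))
                  (trans (cong (Inverse.from c) e) (Inverse.strictlyInverseʳ c _))))

-- Strictly ascending pairs  a < b  of elements of Fin r.
data Pair : ℕ → Set where
  from-zero : ∀ {r} → Fin r → Pair (suc r)
  shift     : ∀ {r} → Pair r → Pair (suc r)

small large : ∀ {r} → Pair r → Fin r
small (from-zero b) = zero
small (shift p)     = suc (small p)
large (from-zero b) = suc b
large (shift p)     = suc (large p)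

small≢large : ∀ {r} (p : Pair r) → small p ≢ large p
small≢large (from-zero b) ()
small≢large (shift p)     e = small≢large p (suc-injective e)

pairs : ℕ → ℕ
pairs zero    = 0
pairs (suc r) = r + pairs r

card-Pair : ∀ r → Card (Pair r) (pairs r)
card-Pair zero    = mk↔ₛ′ (λ ()) (λ ()) (λ ()) (λ ())
card-Pair (suc r) = card-via (card-⊎ ↔-refl (card-Pair r)) to from to-from from-to
  where
  to : Fin r ⊎ Pair r → Pair (suc r)
  to (inj₁ b) = from-zero b
  to (inj₂ p) = shift p
  from : Pair (suc r) → Fin r ⊎ Pair r
  from (from-zero b) = inj₁ b
  from (shift p)     = inj₂ p
  to-from : ∀ p → to (from p) ≡ p
  to-from (from-zero b) = refl
  to-from (shift p)     = refl
  from-to : ∀ x → from (to x) ≡ x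
  from-to (inj₁ b) = refl
  from-to (inj₂ p) = refl

-- Ordered pairs of Fin r split into ascending pairs, descending pairs and the diagonal.
pairs-double : ∀ r → pairs r + pairs r + r ≡ r * r
pairs-double zero    = refl
pairs-double (suc r) = begin
  (r + pairs r) + (r + pairs r) + suc r ≡⟨ solve 2 (λ r p → (r :+ p) :+ (r :+ p) :+ (con 1 :+ r)
                                                          := (p :+ p :+ r) :+ (r :+ r :+ con 1)) refl r (pairs r) ⟩
  (pairs r + pairs r + r) + (r + r + 1) ≡⟨ cong (_+ (r + r + 1)) (pairs-double r) ⟩
  r * r + (r + r + 1)                   ≡⟨ solve 1 (λ r → r :* r :+ (r :+ r :+ con 1)
                                                          := (con 1 :+ r) :* (con 1 :+ r)) refl r ⟩
  suc r * suc r                         ∎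
  where open ≡-Reasoning
        open +-*-Solver

data Order {r} : Fin r → Fin r → Set where
  ascending  : (p : Pair r) → Order (small p) (large p)
  equal      : (a : Fin r) → Order a a
  descending : (p : Pair r) → Order (large p) (small p)

compare : ∀ {r} (a b : Fin r) → Order a b
compare zero    zero    = equal zero
compare zero    (suc b) = ascending (from-zero b)
compare (suc a) zero    = descending (from-zero a)
compare (suc a) (suc b) with compare a b
... | ascending p  = ascending (shift p)
... | equal a      = equal (suc a)
... | descending p = descending (shift p)

compare-ascending : ∀ {r} (p : Pair r) → compare (small p) (large p) ≡ ascending p
compare-ascending (from-zero b) = refl
compare-ascending (shift p) rewrite compare-ascending p = refl

compare-equal : ∀ {r} (a : Fin r) → compare a a ≡ equal a
compare-equal zero = refl
compare-equal (suc a) rewrite compare-equal a = refl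

compare-descending : ∀ {r} (p : Pair r) → compare (large p) (small p) ≡ descending p
compare-descending (from-zero b) = refl
compare-descending (shift p) rewrite compare-descending p = refl

-- Words over the alphabet Fin r, stored from the outside in, so that
-- reversal and the comparison of the two outer letters are structural.
module Words (r : ℕ) where

  data OWord : ℕ → Set where
    nil  : OWord 0
    one  : Fin r → OWord 1
    wrap : ∀ {m} → Fin r → OWord m → Fin r → OWord (suc (suc m))   -- first letter, middle, last letter

  reverse : ∀ {m} → OWord m → OWord m
  reverse nil          = nil
  reverse (one a)      = one a
  reverse (wrap a w b) = wrap b (reverse w) a

  reverse-involutive : ∀ {m} (w : OWord m) → reverse (reverse w) ≡ w
  reverse-involutive nil          = refl
  reverse-involutive (one a)      = refl
  reverse-involutive (wrap a w b) = cong (λ x → wrap a x b) (reverse-involutive w)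

  revIf : ∀ {m} → Bool → OWord m → OWord m
  revIf false w = w
  revIf true  w = reverse w

  revIf-xor : ∀ {m} b b′ (w : OWord m) → revIf b (revIf b′ w) ≡ revIf (b xor b′) w
  revIf-xor false b′    w = refl
  revIf-xor true  false w = refl
  revIf-xor true  true  w = reverse-involutive w

  revIf-involutive : ∀ {m} b (w : OWord m) → revIf b (revIf b w) ≡ w
  revIf-involutive false w = refl
  revIf-involutive true  w = reverse-involutive w

  Palindrome : ∀ {m} → OWord m → Set
  Palindrome w = reverse w ≡ w

  toOWord : ∀ {m} → (Fin m → Fin r) → OWord m
  toOWord {zero}        f = nil
  toOWord {suc zero}    f = one (f zero)
  toOWord {suc (suc m)} f = wrap (f zero) (toOWord (f ∘ suc ∘ inject₁)) (f (fromℕ (suc m)))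

  fromOWord : ∀ {m} → OWord m → Fin m → Fin r
  fromOWord (one a)      _       = a
  fromOWord (wrap a w b) zero    = a
  fromOWord (wrap a w b) (suc j) with view j
  ... | ‵fromℕ     = b
  ... | ‵inject₁ i = fromOWord w i

  fromOWord-middle : ∀ {m} a (w : OWord m) b i → fromOWord (wrap a w b) (suc (inject₁ i)) ≡ fromOWord w i
  fromOWord-middle a w b i rewrite view-inject₁ i = refl

  fromOWord-last : ∀ {m} a (w : OWord m) b → fromOWord (wrap a w b) (suc (fromℕ m)) ≡ b
  fromOWord-last {m} a w b rewrite view-fromℕ m = refl

  toOWord-cong : ∀ {m} {f g : Fin m → Fin r} → f ≗ g → toOWord f ≡ toOWord g
  toOWord-cong {zero}        f≗g = refl
  toOWord-cong {suc zero}    f≗g = cong one (f≗g zero)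
  toOWord-cong {suc (suc m)} f≗g rewrite f≗g zero | f≗g (fromℕ (suc m)) =
    cong (λ w → wrap _ w _) (toOWord-cong (f≗g ∘ suc ∘ inject₁))

  from-toOWord : ∀ {m} (f : Fin m → Fin r) → fromOWord (toOWord f) ≗ f
  from-toOWord {suc zero}    f zero    = refl
  from-toOWord {suc (suc m)} f zero    = refl
  from-toOWord {suc (suc m)} f (suc j) with view j
  ... | ‵fromℕ     = refl
  ... | ‵inject₁ i = from-toOWord (f ∘ suc ∘ inject₁) i

  to-fromOWord : ∀ {m} (w : OWord m) → toOWord (fromOWord w) ≡ w
  to-fromOWord nil          = refl
  to-fromOWord (one a)      = refl
  to-fromOWord (wrap a w b) = cong₂ (wrap a)
    (trans (toOWord-cong (fromOWord-middle a w b)) (to-fromOWord w)) (fromOWord-last a w b)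

  toOWord-injective : ∀ {m} {f g : Fin m → Fin r} → toOWord f ≡ toOWord g → f ≗ g
  toOWord-injective {f = f} {g} e j =
    trans (sym (from-toOWord f j)) (trans (cong (λ w → fromOWord w j) e) (from-toOWord g j))

  toOWord-opposite : ∀ {m} (f : Fin m → Fin r) → toOWord (f ∘ opposite) ≡ reverse (toOWord f)
  toOWord-opposite {zero}        f = refl
  toOWord-opposite {suc zero}    f = refl
  toOWord-opposite {suc (suc m)} f =
    cong₂ (wrap (f (fromℕ (suc m))))
      (trans (toOWord-cong (λ i → cong (f ∘ inject₁) (opposite-inject₁ i)))
             (toOWord-opposite (f ∘ suc ∘ inject₁)))
      (cong f (opposite-fromℕ (suc m)))

  toOWord-reflectIf : ∀ {m} b (f : Fin m → Fin r) → toOWord (f ∘ reflectIf b) ≡ revIf b (toOWord f)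
  toOWord-reflectIf false f = refl
  toOWord-reflectIf true  f = toOWord-opposite f

  -- Classes of non-palindromic words under reversal, each given by its canonical
  -- representative: either the outer letters differ (and are stored in ascending
  -- order), or they agree and the middle word is itself a class.
  data Class : ℕ → Set where
    differ : ∀ {m} → Pair r → OWord m → Class (suc (suc m))
    agree  : ∀ {m} → Fin r → Class m → Class (suc (suc m))

  representative : ∀ {m} → Class m → OWord m
  representative (differ p w) = wrap (small p) w (large p)
  representative (agree a c)  = wrap a (representative c) a

  -- The class of a word; nothing exactly for palindromes.
  classOf : ∀ {m} → OWord m → Maybe (Class m)
  classOf nil     = nothing
  classOf (one a) = nothing
  classOf (wrap a w b) with compare a b
  ... | ascending p  = just (differ p w)
  ... | equal a      = map (agree a) (classOf w)
  ... | descending p = just (differ p (reverse w))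

  classOf-representative : ∀ {m} (c : Class m) → classOf (representative c) ≡ just c
  classOf-representative (differ p w) rewrite compare-ascending p = refl
  classOf-representative (agree a c) rewrite compare-equal a | classOf-representative c = refl

  classOf-reverse : ∀ {m} (w : OWord m) → classOf (reverse w) ≡ classOf w
  classOf-reverse nil     = refl
  classOf-reverse (one a) = refl
  classOf-reverse (wrap a w b) with compare a b
  ... | ascending p  rewrite compare-descending p | reverse-involutive w = refl
  ... | equal a      rewrite compare-equal a | classOf-reverse w = refl
  ... | descending p rewrite compare-ascending p = refl

  classOf-revIf : ∀ {m} b (w : OWord m) → classOf (revIf b w) ≡ classOf w
  classOf-revIf false w = refl
  classOf-revIf true  w = classOf-reverse w

  -- Representatives are never palindromes: the outer letters differ somewhere.
  representative-non-palindrome : ∀ {m} (c : Class m) → ¬ Palindrome (representative c)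
  representative-non-palindrome (differ p w) e = small≢large p (cong last e)
    where
    last : ∀ {m} → OWord (suc (suc m)) → Fin r
    last (wrap _ _ b) = b
  representative-non-palindrome (agree a c)  e = representative-non-palindrome c (cong middle e)
    where
    middle : ∀ {m} → OWord (suc (suc m)) → OWord m
    middle (wrap _ w _) = w

  classOf-non-palindrome : ∀ {m} (w : OWord m) → ¬ Palindrome w → Σ (Class m) λ c → classOf w ≡ just c
  classOf-non-palindrome nil     ¬pal = ⊥-elim (¬pal refl)
  classOf-non-palindrome (one a) ¬pal = ⊥-elim (¬pal refl)
  classOf-non-palindrome (wrap a w b) ¬pal with compare a b
  ... | ascending p  = differ p w , refl
  ... | descending p = differ p (reverse w) , refl
  ... | equal a with classOf-non-palindrome w (¬pal ∘ cong (λ x → wrap a x a))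
  ...   | c , e rewrite e = agree a c , refl

  classOf-sound : ∀ {m} (w : OWord m) {c} → classOf w ≡ just c →
                  Σ Bool λ b → w ≡ revIf b (representative c)
  classOf-sound nil     ()
  classOf-sound (one a) ()
  classOf-sound (wrap a w b) e with compare a b
  classOf-sound (wrap _ w _) refl | ascending p  = false , refl
  classOf-sound (wrap _ w _) refl | descending p = true , cong (λ x → wrap _ x _) (sym (reverse-involutive w))
  classOf-sound (wrap a w a) e    | equal a with classOf w in e′
  classOf-sound (wrap a w a) refl | equal a | just c with classOf-sound w e′
  ... | false , w≡ = false , cong (λ x → wrap a x a) w≡
  ... | true  , w≡ = true  , cong (λ x → wrap a x a) w≡

  same-class : ∀ {m} (w w′ : OWord m) {c} → classOf w ≡ just c → classOf w′ ≡ just c →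
               Σ Bool λ b → w′ ≡ revIf b w
  same-class w w′ e e′ with classOf-sound w e | classOf-sound w′ e′
  ... | b , w≡ | b′ , w′≡ = b′ xor b , (begin
    w′                                              ≡⟨ w′≡ ⟩
    revIf b′ (representative _)                     ≡⟨ cong (revIf b′) (revIf-involutive b _) ⟨
    revIf b′ (revIf b (revIf b (representative _))) ≡⟨ cong (revIf b′ ∘ revIf b) w≡ ⟨
    revIf b′ (revIf b w)                            ≡⟨ revIf-xor b′ b w ⟩
    revIf (b′ xor b) w                              ∎)
    where open ≡-Reasoning

  representative-rigid : ∀ {m} b (c : Class m) → revIf b (representative c) ≡ representative c → b ≡ false
  representative-rigid false c e = refl
  representative-rigid true  c e = ⊥-elim (representative-non-palindrome c e)

  card-OWord : ∀ m → Card (OWord m) (r ^ m)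
  card-OWord zero = card-via 1↔⊤ (λ _ → nil) (λ _ → tt) (λ { nil → refl }) (λ _ → refl)
  card-OWord (suc zero) = subst (Card _) (sym (*-identityʳ r))
    (card-via ↔-refl one (λ { (one a) → a }) (λ { (one a) → refl }) (λ _ → refl))
  card-OWord (suc (suc m)) = subst (Card _) (cong (r *_) (*-comm (r ^ m) r))
    (card-via (card-× ↔-refl (card-× (card-OWord m) ↔-refl))
      (λ (a , w , b) → wrap a w b) (λ { (wrap a w b) → a , w , b }) (λ { (wrap a w b) → refl }) (λ _ → refl))

  classCount : ℕ → ℕ
  classCount zero          = 0
  classCount (suc zero)    = 0
  classCount (suc (suc m)) = pairs r * r ^ m + r * classCount m

  card-Class : ∀ m → Card (Class m) (classCount m)
  card-Class zero          = mk↔ₛ′ (λ ()) (λ ()) (λ ()) (λ ())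
  card-Class (suc zero)    = mk↔ₛ′ (λ ()) (λ ()) (λ ()) (λ ())
  card-Class (suc (suc m)) =
    card-via (card-⊎ (card-× (card-Pair r) (card-OWord m)) (card-× ↔-refl (card-Class m))) to from to-from from-to
    where
    to : (Pair r × OWord m) ⊎ (Fin r × Class m) → Class (suc (suc m))
    to (inj₁ (p , w)) = differ p w
    to (inj₂ (a , c)) = agree a c
    from : Class (suc (suc m)) → (Pair r × OWord m) ⊎ (Fin r × Class m)
    from (differ p w) = inj₁ (p , w)
    from (agree a c)  = inj₂ (a , c)
    to-from : ∀ c → to (from c) ≡ c
    to-from (differ p w) = refl
    to-from (agree a c)  = refl
    from-to : ∀ x → from (to x) ≡ x
    from-to (inj₁ _) = refl
    from-to (inj₂ _) = refl

  -- Each class accounts for two words, and the palindromes, determined by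
  -- their first ⌈m/2⌉ letters, make up the rest.
  classCount-double : ∀ m → classCount m + classCount m + r ^ ⌈ m /2⌉ ≡ r ^ m
  classCount-double zero          = refl
  classCount-double (suc zero)    = refl
  classCount-double (suc (suc m)) = begin
    (P * T + r * S) + (P * T + r * S) + r * H ≡⟨ solve 5 (λ p t r s h → (p :* t :+ r :* s) :+ (p :* t :+ r :* s) :+ r :* h
                                                                 := (p :+ p) :* t :+ r :* (s :+ s :+ h)) refl P T r S H ⟩
    (P + P) * T + r * (S + S + H)             ≡⟨ cong (λ x → (P + P) * T + r * x) (classCount-double m) ⟩
    (P + P) * T + r * T                       ≡⟨ sym (*-distribʳ-+ T (P + P) r) ⟩
    (P + P + r) * T                           ≡⟨ cong (_* T) (pairs-double r) ⟩
    r * r * T                                 ≡⟨ *-assoc r r T ⟩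
    r * (r * T)                               ∎
    where
    open ≡-Reasoning
    open +-*-Solver
    P T S H : ℕ
    P = pairs r
    T = r ^ m
    S = classCount m
    H = r ^ ⌈ m /2⌉

  classCount-formula : ∀ m → (r ^ m ∸ r ^ ⌈ m /2⌉) / 2 ≡ classCount m
  classCount-formula m = begin
    (r ^ m ∸ H) / 2         ≡⟨ cong (λ x → (x ∸ H) / 2) (sym (classCount-double m)) ⟩
    (S + S + H ∸ H) / 2     ≡⟨ cong (_/ 2) (m+n∸n≡m (S + S) H) ⟩
    (S + S) / 2             ≡⟨ cong (_/ 2) (solve 1 (λ s → s :+ s := s :* con 2) refl S) ⟩
    (S * 2) / 2             ≡⟨ m*n/n≡m S 2 ⟩
    S                       ∎
    where
    open ≡-Reasoning
    open +-*-Solver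
    S H : ℕ
    S = classCount m
    H = r ^ ⌈ m /2⌉

pattern centre  = inj₁ tt
pattern vtx i j = inj₂ (i , j)

two-of-three : ∀ {A : Set} {x y z p q : A} →
               x ≡ p ⊎ x ≡ q → y ≡ p ⊎ y ≡ q → z ≡ p ⊎ z ≡ q → x ≡ y ⊎ x ≡ z ⊎ y ≡ z
two-of-three (inj₁ x≡) (inj₁ y≡) _         = inj₁ (trans x≡ (sym y≡))
two-of-three (inj₂ x≡) (inj₂ y≡) _         = inj₁ (trans x≡ (sym y≡))
two-of-three (inj₁ x≡) (inj₂ _)  (inj₁ z≡) = inj₂ (inj₁ (trans x≡ (sym z≡)))
two-of-three (inj₂ x≡) (inj₁ _)  (inj₂ z≡) = inj₂ (inj₁ (trans x≡ (sym z≡)))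
two-of-three (inj₁ _)  (inj₂ y≡) (inj₂ z≡) = inj₂ (inj₂ (trans y≡ (sym z≡)))
two-of-three (inj₂ _)  (inj₁ y≡) (inj₁ z≡) = inj₂ (inj₂ (trans y≡ (sym z≡)))

inject₁-inject₁≢suc-suc : ∀ {m} (j : Fin m) → inject₁ (inject₁ j) ≢ suc (suc j)
inject₁-inject₁≢suc-suc zero    ()
inject₁-inject₁≢suc-suc (suc j) e = inject₁-inject₁≢suc-suc j (suc-injective e)

toℕ-fromℕ⁻¹ : ∀ {m} {j : Fin (suc m)} → toℕ j ≡ m → j ≡ fromℕ m
toℕ-fromℕ⁻¹ e = toℕ-injective (trans e (sym (toℕ-fromℕ _)))

toℕ-inject₁⁻¹ : ∀ {m} {j : Fin (suc m)} {j′ : Fin m} → toℕ j ≡ toℕ j′ → j ≡ inject₁ j′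
toℕ-inject₁⁻¹ e = toℕ-injective (trans e (sym (toℕ-inject₁ _)))

module Windmill (n k′ : ℕ) where

  k m : ℕ
  k = suc (suc (suc k′))
  m = suc (suc k′)

  G : Graph
  G = DutchWindmill n k

  Vertex : Set
  Vertex = WVertex n k

  last : Fin m
  last = fromℕ (suc k′)

  -- Edges in normal form, with the positions given as elements of Fin rather than by toℕ.
  data Edge : Vertex → Vertex → Set where
    first : ∀ i → Edge centre (vtx i zero)
    final : ∀ i → Edge (vtx i last) centre
    next  : ∀ i j → Edge (vtx i (inject₁ j)) (vtx i (suc j))

  normalise : ∀ {u v} → WEdge n k u v → Edge u v
  normalise (centre-first i zero    _)  = first i
  normalise (centre-first i (suc j) ())
  normalise (last-centre i j e) with toℕ-fromℕ⁻¹ e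
  ... | refl = final i
  normalise (step i j zero    ())
  normalise (step i j (suc j′) e) with toℕ-inject₁⁻¹ (sym (ℕ.suc-injective e))
  ... | refl = next i j′

  edge : ∀ {u v} → Edge u v → Adj G u v
  edge (first i)  = inj₁ (centre-first i zero refl)
  edge (final i)  = inj₁ (last-centre i last (toℕ-fromℕ (suc k′)))
  edge (next i j) = inj₁ (step i (inject₁ j) (suc j) (cong suc (sym (toℕ-inject₁ j))))

  edge-cases : ∀ {u v} → Adj G u v → Edge u v ⊎ Edge v u
  edge-cases (inj₁ e) = inj₁ (normalise e)
  edge-cases (inj₂ e) = inj₂ (normalise e)

  bladeMap : (Fin n → Fin n) → (Fin n → Bool) → Vertex → Vertex
  bladeMap π ε centre    = centre
  bladeMap π ε (vtx i j) = vtx (π i) (reflectIf (ε i) j)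

  bladeMap-edge : ∀ π ε {u v} → Edge u v → Adj G (bladeMap π ε u) (bladeMap π ε v)
  bladeMap-edge π ε (first i) with ε i
  ... | false = edge (first (π i))
  ... | true  = swap (edge (final (π i)))
  bladeMap-edge π ε (final i) with ε i
  ... | false = edge (final (π i))
  ... | true rewrite opposite-fromℕ (suc k′) = swap (edge (first (π i)))
  bladeMap-edge π ε (next i j) with ε i
  ... | false = edge (next (π i) j)
  ... | true rewrite opposite-inject₁ j = swap (edge (next (π i) (opposite j)))

  bladeMap-adjacent : ∀ π ε {u v} → Adj G u v → Adj G (bladeMap π ε u) (bladeMap π ε v)
  bladeMap-adjacent π ε a with edge-cases a
  ... | inj₁ e = bladeMap-edge π ε e
  ... | inj₂ e = swap (bladeMap-edge π ε e)

  bladeMap-inverse : ∀ {π π′ ε ε′} → (∀ i → π′ (π i) ≡ i) → (∀ i → ε′ (π i) ≡ ε i) →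
                     ∀ v → bladeMap π′ ε′ (bladeMap π ε v) ≡ v
  bladeMap-inverse π′π ε′π centre = refl
  bladeMap-inverse {ε = ε} π′π ε′π (vtx i j)
    rewrite π′π i | ε′π i | reflectIf-involutive (ε i) j = refl

  bladeAutomorphism : Permutation′ n → (Fin n → Bool) → Automorphism G
  bladeAutomorphism π ε = record
    { perm    = mk↔ₛ′ to from to∘from from∘to
    ; adj-iff = λ u v → mk⇔ (bladeMap-adjacent _ ε)
                            (subst₂ (Adj G) (from∘to u) (from∘to v) ∘ bladeMap-adjacent _ (ε ∘ (π ⟨$⟩ˡ_)))
    }
    where
    to from : Vertex → Vertex
    to   = bladeMap (π ⟨$⟩ʳ_) ε
    from = bladeMap (π ⟨$⟩ˡ_) (ε ∘ (π ⟨$⟩ˡ_))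
    to∘from : ∀ v → to (from v) ≡ v
    to∘from = bladeMap-inverse (λ _ → inverseʳ π) (λ _ → refl)
    from∘to : ∀ v → from (to v) ≡ v
    from∘to = bladeMap-inverse (λ _ → inverseˡ π) (λ _ → cong ε (inverseˡ π))

  lower upper : Fin n → Fin m → Vertex
  lower i zero    = centre
  lower i (suc j) = vtx i (inject₁ j)
  upper i j with view j
  ... | ‵fromℕ     = centre
  ... | ‵inject₁ j′ = vtx i (suc j′)

  upper-last : ∀ i → upper i last ≡ centre
  upper-last i rewrite view-fromℕ (suc k′) = refl

  upper-inject₁ : ∀ i j → upper i (inject₁ j) ≡ vtx i (suc j)
  upper-inject₁ i j rewrite view-inject₁ j = refl

  lower-inject₁ : ∀ i j → lower i (inject₁ j) ≢ vtx i (suc j)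
  lower-inject₁ i zero    ()
  lower-inject₁ i (suc j) e = inject₁-inject₁≢suc-suc j (cong (λ { (vtx _ x) → x ; centre → zero }) e)

  centre-neighbours : ∀ {v} → Adj G centre v → Σ (Fin n) λ i → v ≡ vtx i zero ⊎ v ≡ vtx i last
  centre-neighbours a with edge-cases a
  ... | inj₁ (first i) = i , inj₁ refl
  ... | inj₂ (final i) = i , inj₂ refl

  blade-neighbours : ∀ {i j v} → Adj G (vtx i j) v → v ≡ lower i j ⊎ v ≡ upper i j
  blade-neighbours a with edge-cases a
  ... | inj₁ (final i)  = inj₂ (sym (upper-last i))
  ... | inj₁ (next i j) = inj₂ (sym (upper-inject₁ i j))
  ... | inj₂ (first i)  = inj₁ refl
  ... | inj₂ (next i j) = inj₁ refl

  adjacent-along : ∀ {x y v} → x ≡ y → Adj G x v → Adj G y v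
  adjacent-along refl a = a

  record SelfEmbedding : Set where
    field
      to           : Vertex → Vertex
      to-injective : Injective _≡_ _≡_ to
      to-adjacent  : ∀ {u v} → Adj G u v → Adj G (to u) (to v)
  open SelfEmbedding

  automorphism-embedding : Automorphism G → SelfEmbedding
  automorphism-embedding σ = record
    { to           = apply σ
    ; to-injective = Injection.injective (↔⇒↣ (perm σ))
    ; to-adjacent  = λ {u} {v} → Equivalence.to (adj-iff σ u v)
    }

  reflect : Vertex → Vertex
  reflect = bladeMap (λ i → i) (λ _ → true)

  reflect-involutive : ∀ v → reflect (reflect v) ≡ v
  reflect-involutive = bladeMap-inverse (λ _ → refl) (λ _ → refl)

  reflect-after : SelfEmbedding → SelfEmbedding
  reflect-after e = record
    { to           = reflect ∘ to e
    ; to-injective = λ x≡y → to-injective e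
                       (trans (sym (reflect-involutive _)) (trans (cong reflect x≡y) (reflect-involutive _)))
    ; to-adjacent  = bladeMap-adjacent _ _ ∘ to-adjacent e
    }

  -- With two blades, the centre has three distinct neighbours while every other
  -- vertex has only two; hence every self-embedding fixes the centre.
  centre-fixed : (e : SelfEmbedding) (i₀ i₁ : Fin n) → i₀ ≢ i₁ → to e centre ≡ centre
  centre-fixed e i₀ i₁ i₀≢i₁ with to e centre in eq
  ... | centre  = refl
  ... | vtx i j = ⊥-elim $ pairwise-distinct
    (two-of-three (image-neighbour (edge (first i₀))) (image-neighbour (edge (first i₁)))
                  (image-neighbour (swap (edge (final i₀)))))
    where
    image-neighbour : ∀ {v} → Adj G centre v → to e v ≡ lower i j ⊎ to e v ≡ upper i j
    image-neighbour a = blade-neighbours (adjacent-along eq (to-adjacent e a))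
    blade : Vertex → Fin n
    blade (vtx b _) = b
    blade centre    = i₀
    pairwise-distinct : to e (vtx i₀ zero) ≡ to e (vtx i₁ zero) ⊎ to e (vtx i₀ zero) ≡ to e (vtx i₀ last)
                        ⊎ to e (vtx i₁ zero) ≡ to e (vtx i₀ last) → ⊥
    pairwise-distinct (inj₁ e₀₁)        = i₀≢i₁ (cong blade (to-injective e e₀₁))
    pairwise-distinct (inj₂ (inj₁ e₀₀)) with to-injective e e₀₀
    ... | ()
    pairwise-distinct (inj₂ (inj₂ e₁₀)) with to-injective e e₁₀
    ... | ()

  -- A self-embedding fixing the centre and sending the first vertex of blade i to
  -- the first vertex of blade i′ runs along the two blades in step: the image of
  -- each next vertex is a neighbour, but not the image of the previous one.
  along-blade : (e : SelfEmbedding) → to e centre ≡ centre → ∀ i i′ →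
                to e (vtx i zero) ≡ vtx i′ zero → ∀ j → to e (vtx i j) ≡ vtx i′ j
  along-blade e fixed i i′ start j = proj₁ (<-weakInduction Aligned (start , fixed) advance j)
    where
    Aligned : Fin m → Set
    Aligned j = to e (vtx i j) ≡ vtx i′ j × to e (lower i j) ≡ lower i′ j
    advance : ∀ j → Aligned (inject₁ j) → Aligned (suc j)
    advance j (here , below) = there , here
      where
      there : to e (vtx i (suc j)) ≡ vtx i′ (suc j)
      there with blade-neighbours (adjacent-along here (to-adjacent e (edge (next i j))))
      ... | inj₁ down = ⊥-elim (lower-inject₁ i j (to-injective e (trans below (sym down))))
      ... | inj₂ up   = trans up (upper-inject₁ i′ j)

  rigid : (e : SelfEmbedding) → to e centre ≡ centre →
          ∀ i → Σ (Fin n) λ i′ → Σ Bool λ b → ∀ j → to e (vtx i j) ≡ vtx i′ (reflectIf b j)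
  rigid e fixed i with centre-neighbours (adjacent-along fixed (to-adjacent e (edge (first i))))
  ... | i′ , inj₁ start = i′ , false , along-blade e fixed i i′ start
  ... | i′ , inj₂ start = i′ , true , λ j →
    trans (sym (reflect-involutive _))
          (cong reflect (along-blade (reflect-after e) (cong reflect fixed) i i′
                           (trans (cong reflect start) (cong (vtx i′) (opposite-fromℕ (suc k′)))) j))

module Characterisation (n′ k′ r : ℕ) where
  open Windmill (suc (suc n′)) k′
  open Words r

  n : ℕ
  n = suc (suc n′)

  automorphism-fixes-centre : (σ : Automorphism G) → apply σ centre ≡ centre
  automorphism-fixes-centre σ = centre-fixed (automorphism-embedding σ) zero (suc zero) (λ ())

  module Exchange (i₀ i₁ : Fin n) (b : Bool) where
    exchange : Automorphism G
    exchange = bladeAutomorphism (transpose i₀ i₁) (λ i → (does (i ≟ i₀) ∨ does (i ≟ i₁)) ∧ b)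

    exchange-i₀ : ∀ j → apply exchange (vtx i₀ j) ≡ vtx i₁ (reflectIf b j)
    exchange-i₀ j rewrite dec-true (i₀ ≟ i₀) refl = refl

    exchange-i₁ : ∀ j → apply exchange (vtx i₁ j) ≡ vtx i₀ (reflectIf b j)
    exchange-i₁ j = by-cases (i₁ ≟ i₀)
      where
      by-cases : Dec (i₁ ≡ i₀) → apply exchange (vtx i₁ j) ≡ vtx i₀ (reflectIf b j)
      by-cases (yes i₁≡i₀) =
        subst (λ x → apply exchange (vtx x j) ≡ vtx i₀ (reflectIf b j)) (sym i₁≡i₀)
              (subst (λ x → apply exchange (vtx i₀ j) ≡ vtx x (reflectIf b j)) i₁≡i₀ (exchange-i₀ j))
      by-cases (no i₁≢i₀) rewrite dec-false (i₁ ≟ i₀) i₁≢i₀ | dec-true (i₁ ≟ i₁) refl = refl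

    exchange-other : ∀ {i} j → i ≢ i₀ → i ≢ i₁ → apply exchange (vtx i j) ≡ vtx i j
    exchange-other {i} j i≢i₀ i≢i₁ rewrite dec-false (i ≟ i₀) i≢i₀ | dec-false (i ≟ i₁) i≢i₁ = refl

    exchange-preserves : (c : Labeling G r) → (∀ j → c (vtx i₁ (reflectIf b j)) ≡ c (vtx i₀ j)) →
                         Preserves exchange c
    exchange-preserves c same centre = refl
    exchange-preserves c same (vtx i j) = by-cases (i ≟ i₀) (i ≟ i₁)
      where
      by-cases : Dec (i ≡ i₀) → Dec (i ≡ i₁) → c (apply exchange (vtx i j)) ≡ c (vtx i j)
      by-cases (yes i≡i₀) _ rewrite i≡i₀ = trans (cong c (exchange-i₀ j)) (same j)
      by-cases (no _) (yes i≡i₁) rewrite i≡i₁ =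
        trans (cong c (exchange-i₁ j)) (sym (trans (cong (c ∘ vtx i₁) (sym (reflectIf-involutive b j))) (same _)))
      by-cases (no i≢i₀) (no i≢i₁) = cong c (exchange-other j i≢i₀ i≢i₁)

  -- Under a distinguishing labeling, no blade repeats the labels of another one,
  -- nor (reading backwards) its own: otherwise the exchange would have to fix the
  -- first vertex of blade i₀, which it sends to blade i₁, to its last vertex when b.
  blades-differ : (c : Labeling G r) → Distinguishing c → ∀ i₀ i₁ b →
                  (∀ j → c (vtx i₁ (reflectIf b j)) ≡ c (vtx i₀ j)) → i₀ ≡ i₁ × b ≡ false
  blades-differ c dist i₀ i₁ b same
    with trans (sym (exchange-i₀ zero)) (dist exchange (exchange-preserves c same) (vtx i₀ zero))
    where open Exchange i₀ i₁ b
  blades-differ c dist i₀ i₁ false same | refl = refl , refl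

  bladeWord : Labeling G r → Fin n → OWord m
  bladeWord c i = toOWord (c ∘ vtx i)

  labeling-bound : HasDistLabeling G r → n ≤ classCount m
  labeling-bound (c , dist) = injection-bound (card-Class m) (proj₁ ∘ class) class-injective
    where
    non-palindrome : ∀ i → ¬ Palindrome (bladeWord c i)
    non-palindrome i pal with proj₂ (blades-differ c dist i i true symmetric)
      where
      symmetric : c ∘ vtx i ∘ opposite ≗ c ∘ vtx i
      symmetric = toOWord-injective (trans (toOWord-opposite (c ∘ vtx i)) pal)
    ... | ()
    class : ∀ i → Σ (Class m) λ cl → classOf (bladeWord c i) ≡ just cl
    class i = classOf-non-palindrome (bladeWord c i) (non-palindrome i)
    class-injective : ∀ {i i′} → proj₁ (class i) ≡ proj₁ (class i′) → i ≡ i′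
    class-injective {i} {i′} e
      with same-class (bladeWord c i) (bladeWord c i′) (proj₂ (class i)) (trans (proj₂ (class i′)) (cong just (sym e)))
    ... | b , similar = sym (proj₁ (blades-differ c dist i′ i b (sym ∘ same-labels)))
      where
      same-labels : c ∘ vtx i′ ≗ c ∘ vtx i ∘ reflectIf b
      same-labels = toOWord-injective (trans similar (sym (toOWord-reflectIf b (c ∘ vtx i))))

  -- Conversely, n distinct classes give a distinguishing labeling: label blade i by the
  -- representative of the i-th class.
  labeling-from-classes : n ≤ classCount m → HasDistLabeling G r
  labeling-from-classes n≤ = label , distinguishing
    where
    class : Fin n → Class m
    class = proj₁ (distinct-elements (card-Class m) n≤)
    word : Fin n → OWord m
    word = representative ∘ class
    label : Labeling G r
    label centre    = fromOWord (word zero) zero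
    label (vtx i j) = fromOWord (word i) j
    matched : ∀ i i′ b → (∀ j → label (vtx i′ (reflectIf b j)) ≡ label (vtx i j)) → i′ ≡ i × b ≡ false
    matched i i′ b same =
      class-equal , representative-rigid b (class i) (subst (λ x → revIf b (word x) ≡ word i) class-equal words)
      where
      open ≡-Reasoning
      words : revIf b (word i′) ≡ word i
      words = begin
        revIf b (word i′)                           ≡⟨ cong (revIf b) (to-fromOWord (word i′)) ⟨
        revIf b (toOWord (fromOWord (word i′)))     ≡⟨ toOWord-reflectIf b (fromOWord (word i′)) ⟨
        toOWord (fromOWord (word i′) ∘ reflectIf b) ≡⟨ toOWord-cong same ⟩
        toOWord (fromOWord (word i))                ≡⟨ to-fromOWord (word i) ⟩
        word i                                      ∎
      class-equal : i′ ≡ i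
      class-equal = proj₂ (distinct-elements (card-Class m) n≤) (just-injective (begin
        just (class i′)            ≡⟨ classOf-representative (class i′) ⟨
        classOf (word i′)          ≡⟨ classOf-revIf b (word i′) ⟨
        classOf (revIf b (word i′)) ≡⟨ cong classOf words ⟩
        classOf (word i)           ≡⟨ classOf-representative (class i) ⟩
        just (class i)             ∎))
    distinguishing : Distinguishing label
    distinguishing σ preserves centre = automorphism-fixes-centre σ
    distinguishing σ preserves (vtx i j)
      with rigid (automorphism-embedding σ) (automorphism-fixes-centre σ) i
    ... | i′ , b , moves with matched i i′ b (λ j → trans (cong label (sym (moves j))) (preserves (vtx i j)))
    ... | refl , refl = moves j

  characterisation : HasDistLabeling G r ⇔ WindmillBound n k r
  characterisation = mk⇔ (λ h → subst (n ≤_) (sym (classCount-formula m)) (labeling-bound h))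
                         (λ bound → labeling-from-classes (subst (n ≤_) (classCount-formula m) bound))

IsLeast-cong : ∀ {P Q : ℕ → Set} {d} → (∀ r → P r ⇔ Q r) → IsLeast P d ⇔ IsLeast Q d
IsLeast-cong P⇔Q = mk⇔ (λ (Pd , least) → to (P⇔Q _) Pd , λ r Qr → least r (from (P⇔Q r) Qr))
                       (λ (Qd , least) → from (P⇔Q _) Qd , λ r Pr → least r (to (P⇔Q r) Pr))
  where open Equivalence

theorem2p1 : (n k : ℕ) → 2 ≤ n → 3 ≤ k → (d : ℕ) →
               IsDistinguishingNumber (DutchWindmill n k) d ⇔ IsLeast (WindmillBound n k) d
theorem2p1 (suc (suc n′)) (suc (suc (suc k′))) _ _ _ = IsLeast-cong (Characterisation.characterisation n′ k′)
theorem2p1 zero                _                  ()             _                    _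
theorem2p1 (suc zero)          _                  (s≤s ())       _                    _
theorem2p1 (suc (suc _))       zero               _              ()                   _
theorem2p1 (suc (suc _))       (suc zero)         _              (s≤s ())             _
theorem2p1 (suc (suc _))       (suc (suc zero))   _              (s≤s (s≤s ()))       _
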